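{- Let $n,\delta\in\mathbb{N}$ with $\delta\geq 3$ and $n\geq 8$. If $G$ is a connected triangle-free graph of order $n$, minimum degree $\delta$ and diameter $d$, then \[\pi(G)\geq \frac{\delta(d-4)(d-1)}{8(n-1)}.\]
   Context: All graphs are finite and simple. For a connected graph $G$ of order $n\ge 2$ and a vertex $v$, $\overline{\sigma}(v)=\frac{1}{n-1}\sum_{w\in V(G)}d(v,w)$, where $d$ is the shortest-path distance, and the proximity is $\pi(G)=\min_{v\in V(G)}\overline{\sigma}(v)$. The diameter is the maximum distance between two vertices. Triangle-free means no $K_3$ subgraph. -}

module Defs where

open import Data.Bool using (Bool; true; false; if_then_else_)
open import Data.Nat as ℕ using (ℕ; zero; suc; _≤_; _∸_)
open import Data.Fin using (Fin)
open import Data.List using (List; []; _∷_; map; allFin; foldr)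
open import Data.Nat.ListAction using (sum)
open import Data.Integer as ℤ using (ℤ; +_)
open import Data.Rational as ℚ using (ℚ; _/_; _⊓_)
open import Data.Product using (Σ; ∃; ∃-syntax; _×_; _,_)
open import Data.Empty using (⊥)
open import Relation.Binary.PropositionalEquality using (_≡_)

record Graph (n : ℕ) : Set where
  field
    adj   : Fin n → Fin n → Bool
    sym   : ∀ u v → adj u v ≡ adj v u
    irrefl : ∀ v → adj v v ≡ false
open Graph public

data Walk {n : ℕ} (G : Graph n) : Fin n → Fin n → ℕ → Set where
  nil  : ∀ {u} → Walk G u u 0
  cons : ∀ {u w v k} → adj G u w ≡ true → Walk G w v k → Walk G u v (suc k)

Connected : ∀ {n} → Graph n → Set
Connected G = ∀ u v → ∃[ k ] Walk G u v k

IsDistance : ∀ {n} → Graph n → (Fin n → Fin n → ℕ) → Set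
IsDistance G dist =
  ∀ u v → Walk G u v (dist u v) × (∀ k → Walk G u v k → dist u v ≤ k)

IsDiameter : ∀ {n} → (Fin n → Fin n → ℕ) → ℕ → Set
IsDiameter {n} dist D = (∀ u v → dist u v ≤ D) × (∃[ u ] ∃[ v ] dist u v ≡ D)

degree : ∀ {n} → Graph n → Fin n → ℕ
degree {n} G v = sum (map (λ w → if adj G v w then 1 else 0) (allFin n))

IsMinDegree : ∀ {n} → Graph n → ℕ → Set
IsMinDegree G δ = (∀ v → δ ≤ degree G v) × (∃[ v ] degree G v ≡ δ)

TriangleFree : ∀ {n} → Graph n → Set
TriangleFree G = ∀ u v w → adj G u v ≡ true → adj G v w ≡ true → adj G u w ≡ true → ⊥

-- a / m as a rational; the value for m = 0 is an arbitrary convention (0),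
-- never used below since all denominators are positive (n ≥ 8).
frac : ℤ → ℕ → ℚ
frac a zero    = ℚ.0ℚ
frac a (suc m) = a / suc m

-- minimum of a list of rationals (0 on the empty list; unused, n ≥ 2)
minList : List ℚ → ℚ
minList []       = ℚ.0ℚ
minList (x ∷ xs) = foldr _⊓_ x xs

sigmaBar : ∀ {n} → (Fin n → Fin n → ℕ) → Fin n → ℚ
sigmaBar {n} dist v = frac (+ sum (map (dist v) (allFin n))) (n ∸ 1)

proximity : ∀ {n} → (Fin n → Fin n → ℕ) → ℚ
proximity {n} dist = minList (map (sigmaBar dist) (allFin n))

-- Fix a vertex v and a diametral geodesic x₀ … x_d.  In a triangle-free graph a vertex z
-- is adjacent to at most two of the x_q, and then only to two at distance 2; every such z
-- has d(v,z) ≥ d(v,x_q) − 1.  Counting the pairs (q, z) with z ∼ x_q therefore gives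
-- δ · Σ_q (d(v,x_q) − 1) ≤ 2 Σ_z d(v,z).  Pairing x_q with x_{d−q}, the triangle
-- inequality gives d(v,x_q) + d(v,x_{d−q}) ≥ d − 2q, so Σ_q (d(v,x_q) − 1) ≥ (d−4)(d−1)/4,
-- and Σ_z d(v,z) ≥ δ(d−4)(d−1)/8 for every v.
module Submission where

open import Defs renaming (sym to adj-sym)
open import Data.Bool using (true; false; if_then_else_)
open import Data.Empty using (⊥; ⊥-elim)
open import Data.Fin as Fin using (Fin)
open import Data.Integer as ℤ using (ℤ; +_)
import Data.Integer.Properties as ℤ
import Data.Integer.Tactic.RingSolver as ℤ-Solver
open import Data.List using (List; []; _∷_; map; allFin; foldr; tabulate)
open import Data.Nat as ℕ using (ℕ; zero; suc; _+_; _*_; _∸_; _≤_; _<_; z≤n; s≤s)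
open import Data.Nat.ListAction using (sum)
open import Data.Nat.Properties
open import Data.Nat.Tactic.RingSolver using (solve-∀)
open import Data.Product using (_,_; proj₁; proj₂)
open import Data.Rational as ℚ using (ℚ; _⊓_)
import Data.Rational.Properties as ℚ
open import Data.Rational.Unnormalised using (mkℚᵘ; *≤*)
import Data.Rational.Unnormalised.Properties as ℚᵘ
open import Relation.Binary.PropositionalEquality
open import Relation.Nullary using (yes; no)

∑< : ℕ → (ℕ → ℕ) → ℕ
∑< zero    f = 0
∑< (suc m) f = ∑< m f + f m

∑<-mono-≤ : ∀ m {f g : ℕ → ℕ} → (∀ q → q < m → f q ≤ g q) → ∑< m f ≤ ∑< m g
∑<-mono-≤ zero    f≤g = z≤n
∑<-mono-≤ (suc m) f≤g =
  +-mono-≤ (∑<-mono-≤ m (λ q q<m → f≤g q (m<n⇒m<1+n q<m))) (f≤g m ≤-refl)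

∑<-≡0 : ∀ m (f : ℕ → ℕ) → (∀ q → q < m → f q ≡ 0) → ∑< m f ≡ 0
∑<-≡0 zero    f f≡0 = refl
∑<-≡0 (suc m) f f≡0 =
  cong₂ _+_ (∑<-≡0 m f (λ q q<m → f≡0 q (m<n⇒m<1+n q<m))) (f≡0 m ≤-refl)

∑<-suc : ∀ k (f : ℕ → ℕ) → ∑< (suc k) f ≡ f 0 + ∑< k (λ q → f (suc q))
∑<-suc zero    f = +-comm 0 (f 0)
∑<-suc (suc k) f = begin
  ∑< (suc k) f + f (suc k)                    ≡⟨ cong (_+ f (suc k)) (∑<-suc k f) ⟩
  f 0 + ∑< k (λ q → f (suc q)) + f (suc k)    ≡⟨ +-assoc (f 0) _ _ ⟩
  f 0 + ∑< (suc k) (λ q → f (suc q))          ∎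
  where open ≡-Reasoning

*-distribˡ-∑< : ∀ m c (f : ℕ → ℕ) → c * ∑< m f ≡ ∑< m (λ q → c * f q)
*-distribˡ-∑< zero    c f = *-zeroʳ c
*-distribˡ-∑< (suc m) c f =
  trans (*-distribˡ-+ c (∑< m f) (f m)) (cong (_+ c * f m) (*-distribˡ-∑< m c f))

∑<-≤-singleNonzero : ∀ m (f : ℕ → ℕ) M → (∀ q → q < m → f q ≤ M) →
  (∀ q r → q < r → r < m → f q ≢ 0 → f r ≢ 0 → ⊥) → ∑< m f ≤ M
∑<-≤-singleNonzero zero    f M f≤M unique = z≤n
∑<-≤-singleNonzero (suc m) f M f≤M unique with f m ≟ 0
... | yes fm≡0 rewrite fm≡0 | +-identityʳ (∑< m f) =
  ∑<-≤-singleNonzero m f M (λ q q<m → f≤M q (m<n⇒m<1+n q<m))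
    (λ q r q<r r<m → unique q r q<r (m<n⇒m<1+n r<m))
... | no fm≢0 = subst (_≤ M) (sym (cong (_+ f m) (∑<-≡0 m f earlier≡0))) (f≤M m ≤-refl)
  where
  earlier≡0 : ∀ q → q < m → f q ≡ 0
  earlier≡0 q q<m with f q ≟ 0
  ... | yes fq≡0 = fq≡0
  ... | no fq≢0  = ⊥-elim (unique q m q<m ≤-refl fq≢0 fm≢0)

∑<-≤-twoNonzeros : ∀ m (f : ℕ → ℕ) M → (∀ q → q < m → f q ≤ M) →
  (∀ q r → q < r → r < m → f q ≢ 0 → f r ≢ 0 → r ≡ 2 + q) → ∑< m f ≤ M + M
∑<-≤-twoNonzeros zero    f M f≤M gap = z≤n
∑<-≤-twoNonzeros (suc m) f M f≤M gap with f m ≟ 0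
... | yes fm≡0 rewrite fm≡0 | +-identityʳ (∑< m f) =
  ∑<-≤-twoNonzeros m f M (λ q q<m → f≤M q (m<n⇒m<1+n q<m))
    (λ q r q<r r<m → gap q r q<r (m<n⇒m<1+n r<m))
... | no fm≢0 =
  +-mono-≤ (∑<-≤-singleNonzero m f M (λ q q<m → f≤M q (m<n⇒m<1+n q<m)) unique) (f≤M m ≤-refl)
  where
  -- two earlier nonzero terms would both lie exactly 2 below the last one
  unique : ∀ q r → q < r → r < m → f q ≢ 0 → f r ≢ 0 → ⊥
  unique q r q<r r<m fq≢0 fr≢0 = <-irrefl q≡r q<r
    where
    q≡r : q ≡ r
    q≡r = suc-injective (suc-injective
      (trans (sym (gap q m (<-trans q<r r<m) ≤-refl fq≢0 fm≢0))
                  (gap r m r<m ≤-refl fr≢0 fm≢0)))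

q<r≤2+q⇒r≡2+q : ∀ {q r} → q < r → r ≤ 2 + q → r ≢ 1 + q → r ≡ 2 + q
q<r≤2+q⇒r≡2+q {zero}  {suc zero}          _         _                 r≢1 = ⊥-elim (r≢1 refl)
q<r≤2+q⇒r≡2+q {zero}  {suc (suc zero)}    _         _                 _   = refl
q<r≤2+q⇒r≡2+q {zero}  {suc (suc (suc r))} _         (s≤s (s≤s ()))
q<r≤2+q⇒r≡2+q {suc q} {suc r}             (s≤s q<r) (s≤s r≤2+q)       r≢  =
  cong suc (q<r≤2+q⇒r≡2+q q<r r≤2+q (λ r≡ → r≢ (cong suc r≡)))

module _ {A : Set} where

  sum-map-+ : ∀ (xs : List A) (f g : A → ℕ) →
    sum (map (λ z → f z + g z) xs) ≡ sum (map f xs) + sum (map g xs)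
  sum-map-+ []       f g = refl
  sum-map-+ (x ∷ xs) f g =
    trans (cong (λ s → f x + g x + s) (sum-map-+ xs f g)) (+-interchange (f x) (g x) _ _)
    where
    +-interchange : ∀ a b c d → a + b + (c + d) ≡ a + c + (b + d)
    +-interchange = solve-∀

  sum-map-*ʳ : ∀ (xs : List A) (f : A → ℕ) c → sum (map (λ z → f z * c) xs) ≡ sum (map f xs) * c
  sum-map-*ʳ []       f c = refl
  sum-map-*ʳ (x ∷ xs) f c =
    trans (cong (λ s → f x * c + s) (sum-map-*ʳ xs f c)) (sym (*-distribʳ-+ c (f x) _))

  sum-map-mono-≤ : ∀ (xs : List A) {f g : A → ℕ} → (∀ z → f z ≤ g z) →
    sum (map f xs) ≤ sum (map g xs)
  sum-map-mono-≤ []       f≤g = z≤n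
  sum-map-mono-≤ (x ∷ xs) f≤g = +-mono-≤ (f≤g x) (sum-map-mono-≤ xs f≤g)

  sum-map-zero : ∀ (xs : List A) → sum (map (λ _ → 0) xs) ≡ 0
  sum-map-zero []       = refl
  sum-map-zero (x ∷ xs) = sum-map-zero xs

  ∑<-sum-map-comm : ∀ m (xs : List A) (f : ℕ → A → ℕ) →
    ∑< m (λ q → sum (map (f q) xs)) ≡ sum (map (λ z → ∑< m (λ q → f q z)) xs)
  ∑<-sum-map-comm zero    xs f = sym (sum-map-zero xs)
  ∑<-sum-map-comm (suc m) xs f =
    trans (cong (_+ sum (map (f m) xs)) (∑<-sum-map-comm m xs f))
          (sym (sum-map-+ xs (λ z → ∑< m (λ q → f q z)) (f m)))

-- Lower bound for ∑_{q<k} (e q ∸ 1) when e i + e j ≥ j − i: pair q with k − 1 − q.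
pairedGaps : ℕ → ℕ
pairedGaps zero            = 0
pairedGaps (suc zero)      = 0
pairedGaps (suc (suc k))   = (k ∸ 1) + pairedGaps k

m+n∸2≤[m∸1]+[n∸1] : ∀ m n → m + n ∸ 2 ≤ (m ∸ 1) + (n ∸ 1)
m+n∸2≤[m∸1]+[n∸1] zero    n       = ∸-monoʳ-≤ n (s≤s z≤n)
m+n∸2≤[m∸1]+[n∸1] (suc m) zero    = m∸n≤m (m + 0) 1
m+n∸2≤[m∸1]+[n∸1] (suc m) (suc n) = ≤-reflexive (cong (_∸ 1) (+-suc m n))

pairedGaps-≤-∑< : ∀ k (e : ℕ → ℕ) → (∀ i j → i ≤ j → j < k → j ≤ i + (e i + e j)) →
  pairedGaps k ≤ ∑< k (λ q → e q ∸ 1)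
pairedGaps-≤-∑< zero          e spread = z≤n
pairedGaps-≤-∑< (suc zero)    e spread = z≤n
pairedGaps-≤-∑< (suc (suc k)) e spread = begin
  (k ∸ 1) + pairedGaps k                       ≤⟨ +-mono-≤ outerPair inner ⟩
  (h 0 + h (suc k)) + ∑< k (λ q → h (suc q))   ≡⟨ rearrange (h 0) _ (h (suc k)) ⟩
  h 0 + ∑< (suc k) (λ q → h (suc q))           ≡⟨ sym (∑<-suc (suc k) h) ⟩
  ∑< (suc (suc k)) h                           ∎
  where
  open ≤-Reasoning
  h : ℕ → ℕ
  h q = e q ∸ 1
  outerPair : k ∸ 1 ≤ h 0 + h (suc k)
  outerPair = ≤-trans (∸-monoˡ-≤ 2 (spread 0 (suc k) z≤n ≤-refl)) (m+n∸2≤[m∸1]+[n∸1] (e 0) (e (suc k)))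
  inner : pairedGaps k ≤ ∑< k (λ q → h (suc q))
  inner = pairedGaps-≤-∑< k (λ q → e (suc q))
    (λ i j i≤j j<k → ≤-pred (spread (suc i) (suc j) (s≤s i≤j) (s≤s (m<n⇒m<1+n j<k))))
  rearrange : ∀ a b c → a + c + b ≡ a + (b + c)
  rearrange = solve-∀

square-≤-pairedGaps : ∀ k → 1 ≤ k → k * k + 4 ≤ 4 * pairedGaps (suc k) + 5 * k
square-≤-pairedGaps (suc zero)          _ = ≤-refl
square-≤-pairedGaps (suc (suc zero))    _ = m≤m+n 8 2
square-≤-pairedGaps (suc (suc (suc k))) _ = begin
  (3 + k) * (3 + k) + 4                          ≡⟨ expand k ⟩
  ((1 + k) * (1 + k) + 4) + (4 * k + 8)          ≤⟨ +-mono-≤ (square-≤-pairedGaps (suc k) (s≤s z≤n))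
                                                             (+-monoʳ-≤ (4 * k) (m≤n+m 8 6)) ⟩
  (4 * g + 5 * (1 + k)) + (4 * k + 14)           ≡⟨ collect k g ⟩
  4 * (suc k + g) + 5 * (3 + k)                  ∎
  where
  open ≤-Reasoning
  g : ℕ
  g = pairedGaps (2 + k)
  expand : ∀ k → (3 + k) * (3 + k) + 4 ≡ ((1 + k) * (1 + k) + 4) + (4 * k + 8)
  expand = solve-∀
  collect : ∀ k g → (4 * g + 5 * (1 + k)) + (4 * k + 14) ≡ 4 * (suc k + g) + 5 * (3 + k)
  collect = solve-∀

module Walks {n : ℕ} (G : Graph n) where

  _++ʷ_ : ∀ {a b c k l} → Walk G a b k → Walk G b c l → Walk G a c (k + l)
  nil      ++ʷ q = q
  cons e p ++ʷ q = cons e (p ++ʷ q)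

  snocʷ : ∀ {a b c k} → Walk G a b k → adj G b c ≡ true → Walk G a c (suc k)
  snocʷ nil        e = cons e nil
  snocʷ (cons e p) f = cons e (snocʷ p f)

  reverseʷ : ∀ {a b k} → Walk G a b k → Walk G b a k
  reverseʷ nil                    = nil
  reverseʷ {a} (cons {w = w} e p) = snocʷ (reverseʷ p) (trans (adj-sym G w a) e)

  -- the q-th vertex of a walk, clamped to its last vertex for q beyond its length
  vertexAt : ∀ {a b k} → Walk G a b k → ℕ → Fin n
  vertexAt {a} _          zero    = a
  vertexAt {a} nil        (suc q) = a
  vertexAt     (cons e p) (suc q) = vertexAt p q

  takeʷ : ∀ {a b k} (p : Walk G a b k) q → q ≤ k → Walk G a (vertexAt p q) q
  takeʷ p          zero    _       = nil
  takeʷ (cons e p) (suc q) (s≤s h) = cons e (takeʷ p q h)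

  dropʷ : ∀ {a b k} (p : Walk G a b k) q → Walk G (vertexAt p q) b (k ∸ q)
  dropʷ p          zero    = p
  dropʷ nil        (suc q) = nil
  dropʷ (cons e p) (suc q) = dropʷ p q

  vertexAt-adjacent : ∀ {a b k} (p : Walk G a b k) q → q < k →
    adj G (vertexAt p q) (vertexAt p (suc q)) ≡ true
  vertexAt-adjacent (cons e p) zero    _       = e
  vertexAt-adjacent (cons e p) (suc q) (s≤s h) = vertexAt-adjacent p q h

module ShortestPaths {n : ℕ} (G : Graph n)
                     (dist : Fin n → Fin n → ℕ) (isDist : IsDistance G dist) where
  open Walks G

  geodesic : ∀ u v → Walk G u v (dist u v)
  geodesic u v = proj₁ (isDist u v)

  dist-≤-length : ∀ {u v k} → Walk G u v k → dist u v ≤ k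
  dist-≤-length {u} {v} {k} = proj₂ (isDist u v) k

  dist-triangle : ∀ u w v → dist u v ≤ dist u w + dist w v
  dist-triangle u w v = dist-≤-length (geodesic u w ++ʷ geodesic w v)

  dist-sym-≤ : ∀ u v → dist u v ≤ dist v u
  dist-sym-≤ u v = dist-≤-length (reverseʷ (geodesic v u))

  adjacent⇒dist≤1 : ∀ {u v} → adj G u v ≡ true → dist u v ≤ 1
  adjacent⇒dist≤1 e = dist-≤-length (cons e nil)

  ≢⇒1≤dist : ∀ {u v} → u ≢ v → 1 ≤ dist u v
  ≢⇒1≤dist {u} {v} u≢v with dist u v | geodesic u v
  ... | zero  | nil = ⊥-elim (u≢v refl)
  ... | suc _ | _   = s≤s z≤n

  module Geodesic (u w : Fin n) where
    L : ℕ
    L = dist u w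

    x : ℕ → Fin n
    x = vertexAt (geodesic u w)

    geodesic-spread : ∀ i j → i ≤ L → j ≤ L → j ≤ i + dist (x i) (x j)
    geodesic-spread i j i≤L j≤L = +-cancelʳ-≤ (L ∸ j) j (i + D) (begin
      j + (L ∸ j)                        ≡⟨ m+[n∸m]≡n j≤L ⟩
      L                                  ≤⟨ dist-triangle u (x i) w ⟩
      dist u (x i) + dist (x i) w        ≤⟨ +-monoʳ-≤ (dist u (x i)) (dist-triangle (x i) (x j) w) ⟩
      dist u (x i) + (D + dist (x j) w)  ≤⟨ +-mono-≤ (dist-≤-length (takeʷ (geodesic u w) i i≤L))
                                                     (+-monoʳ-≤ D (dist-≤-length (dropʷ (geodesic u w) j))) ⟩
      i + (D + (L ∸ j))                  ≡⟨ +-assoc i D (L ∸ j) ⟨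
      i + D + (L ∸ j)                    ∎)
      where
      open ≤-Reasoning
      D : ℕ
      D = dist (x i) (x j)

    -- a common neighbour of two geodesic vertices keeps them within distance 2,
    -- and triangle-freeness rules out consecutive ones
    commonNeighbour-gap : TriangleFree G → ∀ z q r → q < r → r ≤ L →
      adj G (x q) z ≡ true → adj G (x r) z ≡ true → r ≡ 2 + q
    commonNeighbour-gap triangleFree z q r q<r r≤L qz rz = q<r≤2+q⇒r≡2+q q<r r≤2+q notConsecutive
      where
      r≤2+q : r ≤ 2 + q
      r≤2+q = begin
        r                                  ≤⟨ geodesic-spread q r (≤-trans (<⇒≤ q<r) r≤L) r≤L ⟩
        q + dist (x q) (x r)               ≤⟨ +-monoʳ-≤ q (dist-triangle (x q) z (x r)) ⟩
        q + (dist (x q) z + dist z (x r))  ≤⟨ +-monoʳ-≤ q (+-mono-≤ (adjacent⇒dist≤1 qz)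
                                                (adjacent⇒dist≤1 (trans (adj-sym G z (x r)) rz))) ⟩
        q + 2                              ≡⟨ +-comm q 2 ⟩
        2 + q                              ∎
        where open ≤-Reasoning
      notConsecutive : r ≢ 1 + q
      notConsecutive refl =
        triangleFree (x q) (x (suc q)) z (vertexAt-adjacent (geodesic u w) q r≤L) rz qz

    module Load (triangleFree : TriangleFree G) (δ : ℕ) (δ≤degree : ∀ z → δ ≤ degree G z)
                (v : Fin n) where
      e : ℕ → ℕ
      e q = dist v (x q)

      S : ℕ
      S = sum (map (dist v) (allFin n))

      load : ℕ → Fin n → ℕ
      load q z = (if adj G (x q) z then 1 else 0) * (e q ∸ 1)

      load-≤ : ∀ q z → load q z ≤ dist v z
      load-≤ q z with adj G (x q) z in qz
      ... | false = z≤n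
      ... | true  = subst (_≤ dist v z) (sym (*-identityˡ (e q ∸ 1))) (m≤n+o⇒m∸n≤o (e q) 1 (begin
        e q                        ≤⟨ dist-triangle v z (x q) ⟩
        dist v z + dist z (x q)    ≤⟨ +-monoʳ-≤ (dist v z) (≤-trans (dist-sym-≤ z (x q)) (adjacent⇒dist≤1 qz)) ⟩
        dist v z + 1               ≡⟨ +-comm (dist v z) 1 ⟩
        1 + dist v z               ∎))
        where open ≤-Reasoning

      load≢0⇒adjacent : ∀ q z → load q z ≢ 0 → adj G (x q) z ≡ true
      load≢0⇒adjacent q z load≢0 with adj G (x q) z
      ... | true  = refl
      ... | false = ⊥-elim (load≢0 refl)

      load-at-vertex : ∀ z → ∑< (suc L) (λ q → load q z) ≤ dist v z + dist v z
      load-at-vertex z = ∑<-≤-twoNonzeros (suc L) (λ q → load q z) (dist v z) (λ q _ → load-≤ q z)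
        (λ q r q<r r<1+L q≢0 r≢0 → commonNeighbour-gap triangleFree z q r q<r (≤-pred r<1+L)
           (load≢0⇒adjacent q z q≢0) (load≢0⇒adjacent r z r≢0))

      sum-load≡degree* : ∀ q → sum (map (load q) (allFin n)) ≡ degree G (x q) * (e q ∸ 1)
      sum-load≡degree* q = sum-map-*ʳ (allFin n) (λ z → if adj G (x q) z then 1 else 0) (e q ∸ 1)

      δ*∑<-≤-2S : δ * ∑< (suc L) (λ q → e q ∸ 1) ≤ S + S
      δ*∑<-≤-2S = begin
        δ * ∑< (suc L) (λ q → e q ∸ 1)                            ≡⟨ *-distribˡ-∑< (suc L) δ (λ q → e q ∸ 1) ⟩
        ∑< (suc L) (λ q → δ * (e q ∸ 1))                          ≤⟨ ∑<-mono-≤ (suc L) δ*[e∸1]≤sum-load ⟩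
        ∑< (suc L) (λ q → sum (map (load q) (allFin n)))          ≡⟨ ∑<-sum-map-comm (suc L) (allFin n) load ⟩
        sum (map (λ z → ∑< (suc L) (λ q → load q z)) (allFin n))  ≤⟨ sum-map-mono-≤ (allFin n) load-at-vertex ⟩
        sum (map (λ z → dist v z + dist v z) (allFin n))          ≡⟨ sum-map-+ (allFin n) (dist v) (dist v) ⟩
        S + S                                                     ∎
        where
        open ≤-Reasoning
        δ*[e∸1]≤sum-load : ∀ q → q < suc L → δ * (e q ∸ 1) ≤ sum (map (load q) (allFin n))
        δ*[e∸1]≤sum-load q _ =
          ≤-trans (*-monoˡ-≤ (e q ∸ 1) (δ≤degree (x q))) (≤-reflexive (sym (sum-load≡degree* q)))

      geodesic-spread-from-v : ∀ i j → i ≤ j → j < suc L → j ≤ i + (e i + e j)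
      geodesic-spread-from-v i j i≤j (s≤s j≤L) = begin
        j                        ≤⟨ geodesic-spread i j (≤-trans i≤j j≤L) j≤L ⟩
        i + dist (x i) (x j)     ≤⟨ +-monoʳ-≤ i (dist-triangle (x i) v (x j)) ⟩
        i + (dist (x i) v + e j) ≤⟨ +-monoʳ-≤ i (+-monoˡ-≤ (e j) (dist-sym-≤ (x i) v)) ⟩
        i + (e i + e j)          ∎
        where open ≤-Reasoning

      δ[L²+4]≤8S+δ[5L] : 1 ≤ L → δ * (L * L + 4) ≤ 8 * S + δ * (5 * L)
      δ[L²+4]≤8S+δ[5L] 1≤L = begin
        δ * (L * L + 4)                             ≤⟨ *-monoʳ-≤ δ (square-≤-pairedGaps L 1≤L) ⟩
        δ * (4 * pairedGaps (suc L) + 5 * L)        ≡⟨ distribute δ (pairedGaps (suc L)) L ⟩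
        4 * (δ * pairedGaps (suc L)) + δ * (5 * L)  ≤⟨ +-monoˡ-≤ (δ * (5 * L)) (*-monoʳ-≤ 4 δ*pairedGaps≤2S) ⟩
        4 * (S + S) + δ * (5 * L)                   ≡⟨ cong (_+ δ * (5 * L)) (double S) ⟩
        8 * S + δ * (5 * L)                         ∎
        where
        open ≤-Reasoning
        δ*pairedGaps≤2S : δ * pairedGaps (suc L) ≤ S + S
        δ*pairedGaps≤2S = ≤-trans (*-monoʳ-≤ δ (pairedGaps-≤-∑< (suc L) e geodesic-spread-from-v)) δ*∑<-≤-2S
        distribute : ∀ d g k → d * (4 * g + 5 * k) ≡ 4 * (d * g) + d * (5 * k)
        distribute = solve-∀
        double : ∀ s → 4 * (s + s) ≡ 8 * s
        double = solve-∀

+δ[d-4][d-1]≤+8s : ∀ δ d s → δ * (d * d + 4) ≤ 8 * s + δ * (5 * d) →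
  + δ ℤ.* (+ d ℤ.- + 4) ℤ.* (+ d ℤ.- + 1) ℤ.≤ + 8 ℤ.* + s
+δ[d-4][d-1]≤+8s δ d s δ[d²+4]≤8s+δ[5d] = begin
  + δ ℤ.* (+ d ℤ.- + 4) ℤ.* (+ d ℤ.- + 1)    ≡⟨ expand (+ δ) (+ d) ⟩
  + δ ℤ.* (+ d ℤ.* + d ℤ.+ + 4) ℤ.- C        ≡⟨ cong (ℤ._- C) (sym lhs-cast) ⟩
  + (δ * (d * d + 4)) ℤ.- C                  ≤⟨ ℤ.+-monoˡ-≤ (ℤ.- C) (ℤ.+≤+ δ[d²+4]≤8s+δ[5d]) ⟩
  + (8 * s + δ * (5 * d)) ℤ.- C              ≡⟨ cong (ℤ._- C) rhs-cast ⟩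
  + 8 ℤ.* + s ℤ.+ C ℤ.- C                    ≡⟨ cancel (+ 8 ℤ.* + s) C ⟩
  + 8 ℤ.* + s                                ∎
  where
  open ℤ.≤-Reasoning
  C : ℤ
  C = + δ ℤ.* (+ 5 ℤ.* + d)
  expand : ∀ δ d → δ ℤ.* (d ℤ.- + 4) ℤ.* (d ℤ.- + 1) ≡ δ ℤ.* (d ℤ.* d ℤ.+ + 4) ℤ.- δ ℤ.* (+ 5 ℤ.* d)
  expand = ℤ-Solver.solve-∀
  cancel : ∀ a c → a ℤ.+ c ℤ.- c ≡ a
  cancel = ℤ-Solver.solve-∀
  lhs-cast : + (δ * (d * d + 4)) ≡ + δ ℤ.* (+ d ℤ.* + d ℤ.+ + 4)
  lhs-cast = trans (ℤ.pos-* δ _) (cong (+ δ ℤ.*_) (trans (ℤ.pos-+ (d * d) 4) (cong (ℤ._+ + 4) (ℤ.pos-* d d))))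
  rhs-cast : + (8 * s + δ * (5 * d)) ≡ + 8 ℤ.* + s ℤ.+ C
  rhs-cast = trans (ℤ.pos-+ (8 * s) _)
    (cong₂ ℤ._+_ (ℤ.pos-* 8 s) (trans (ℤ.pos-* δ _) (cong (+ δ ℤ.*_) (ℤ.pos-* 5 d))))

frac-mono-≤ : ∀ a b k l → a ℤ.* + suc l ℤ.≤ b ℤ.* + suc k → frac a (suc k) ℚ.≤ frac b (suc l)
frac-mono-≤ a b k l a*l≤b*k = ℚ.toℚᵘ-cancel-≤
  (ℚᵘ.≤-respˡ-≃ (ℚᵘ.≃-sym (ℚ.toℚᵘ-fromℚᵘ (mkℚᵘ a k)))
  (ℚᵘ.≤-respʳ-≃ (ℚᵘ.≃-sym (ℚ.toℚᵘ-fromℚᵘ (mkℚᵘ b l))) (*≤* a*l≤b*k)))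

frac-8*-≤ : ∀ a s m → a ℤ.≤ + 8 ℤ.* + s → frac a (8 * suc m) ℚ.≤ frac (+ s) (suc m)
frac-8*-≤ a s m a≤8s = frac-mono-≤ a (+ s) (m + 7 * suc m) m (begin
  a ℤ.* + suc m                    ≤⟨ ℤ.*-monoʳ-≤-nonNeg (+ suc m) a≤8s ⟩
  + 8 ℤ.* + s ℤ.* + suc m          ≡⟨ reassociate (+ s) (+ suc m) ⟩
  + s ℤ.* (+ 8 ℤ.* + suc m)        ≡⟨ cong (+ s ℤ.*_) (ℤ.pos-* 8 (suc m)) ⟨
  + s ℤ.* + (8 * suc m)            ∎)
  where
  open ℤ.≤-Reasoning
  reassociate : ∀ s k → + 8 ℤ.* s ℤ.* k ≡ s ℤ.* (+ 8 ℤ.* k)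
  reassociate = ℤ-Solver.solve-∀

≤-minList : ∀ {A : Set} (f : A → ℚ) r → (∀ a → r ℚ.≤ f a) → ∀ a as → r ℚ.≤ minList (map f (a ∷ as))
≤-minList f r r≤f a as = ≤-foldr (f a) as (r≤f a)
  where
  ≤-foldr : ∀ y as → r ℚ.≤ y → r ℚ.≤ foldr _⊓_ y (map f as)
  ≤-foldr y []       r≤y = r≤y
  ≤-foldr y (b ∷ bs) r≤y = ℚ.⊓-glb (r≤f b) (≤-foldr y bs r≤y)

≤-proximity : ∀ {m} (dist : Fin (2 + m) → Fin (2 + m) → ℕ) r → (∀ v → r ℚ.≤ sigmaBar dist v) →
  r ℚ.≤ proximity dist
≤-proximity dist r r≤σ̄ = ≤-minList (sigmaBar dist) r r≤σ̄ Fin.zero (tabulate Fin.suc)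

theorem4p2 : (n δ : ℕ) → 3 ≤ δ → 8 ≤ n →
    (G : Graph n) → Connected G → TriangleFree G → IsMinDegree G δ →
    (dist : Fin n → Fin n → ℕ) → IsDistance G dist →
    (d : ℕ) → IsDiameter dist d →
    frac ((+ δ) ℤ.* ((+ d) ℤ.- (+ 4)) ℤ.* ((+ d) ℤ.- (+ 1))) (8 ℕ.* (n ∸ 1)) ℚ.≤ proximity dist
theorem4p2 (suc (suc m)) δ _ (s≤s (s≤s _)) G _ triangleFree (δ≤degree , _) dist isDist
           d (dist≤d , u , w , refl) =
  ≤-proximity dist _ λ v → let open Load triangleFree δ δ≤degree v in
    frac-8*-≤ _ S m (+δ[d-4][d-1]≤+8s δ L S (δ[L²+4]≤8S+δ[5L] 1≤L))
  where
  open ShortestPaths G dist isDist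
  open Geodesic u w
  1≤L : 1 ≤ L
  1≤L = ≤-trans (≢⇒1≤dist {Fin.zero} {Fin.suc Fin.zero} λ ()) (dist≤d Fin.zero (Fin.suc Fin.zero))
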